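{- Let $G=(V,E)$ and $G'=(V',E')$ be directed acyclic graphs, let $\chi=(\mathfrak m,\mathfrak M)$ be a monitor placement for $G$, and let $f:V\to V'$ be a bijective, distance-increasing embedding $G\hookrightarrow_f G'$; equip $G'$ with the monitor placement $\chi^f=(f(\mathfrak m),f(\mathfrak M))$. Then $\mu(G\mid\chi)\ge\mu(G'\mid\chi^f)$.
   Context: For a DAG $G$, $u\preceq_G v$ means $v$ is reachable from $u$ by a directed path (including $u=v$). An embedding is an injective map $f$ with $u\preceq_G v$ iff $f(u)\preceq_{G'} f(v)$. $d_G(x,y)$ is the length of a shortest directed path from $x$ to $y$ ($\infty$ if none); $f$ is distance-increasing if $d_G(x,y)\le d_{G'}(f(x),f(y))$ for all $x,y$. A monitor placement specifies input nodes $\mathfrak m$ and output nodes $\mathfrak M$; the measurement paths are the directed paths from a node of $\mathfrak m$ to a node of $\mathfrak M$ (under $\mathrm{CSP}$: simple paths with distinct endpoints; under $\mathrm{CAP}^-$: all such directed walks except single-node paths on a node of $\mathfrak m\cap\mathfrak M$). $\mathbb P(v)$ is the set of measurement paths through $v$, $\mathbb P(U)=\bigcup_{u\in U}\mathbb P(u)$; the node set is $k$-identifiable if for all $U\ne W$ with $|U|,|W|\le k$, $\mathbb P(U)\neq\mathbb P(W)$; $\mu$ is the largest such $k\ge0$. -}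

module Defs where

open import Level using (0ℓ)
open import Data.Nat using (ℕ; zero; suc; _≤_)
open import Data.Fin using (Fin)
open import Data.Fin.Subset using (Subset; ∣_∣) renaming (_∈_ to _∈ₛ_)
open import Data.List using (List; head; last; map)
open import Data.Maybe using (just)
open import Data.List.Relation.Unary.Linked using (Linked)
open import Data.List.Relation.Unary.Unique.Propositional using (Unique)
open import Data.List.Membership.Propositional using (_∈_)
open import Data.Product using (Σ; ∃; _×_; _,_)
open import Data.Empty using (⊥)
open import Relation.Nullary using (¬_)
open import Relation.Unary using (Pred)
open import Relation.Binary.PropositionalEquality using (_≡_; _≢_)
open import Function.Bundles using (_⇔_)

Graph : ℕ → Set₁
Graph n = Fin n → Fin n → Set

data Walk {n : ℕ} (E : Graph n) : Fin n → Fin n → ℕ → Set where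
  nil  : ∀ {x} → Walk E x x 0
  cons : ∀ {x y z ℓ} → E x y → Walk E y z ℓ → Walk E x z (suc ℓ)

IsDAG : ∀ {n} → Graph n → Set
IsDAG E = ∀ x ℓ → ¬ Walk E x x (suc ℓ)

_⪯[_]_ : ∀ {n} → Fin n → Graph n → Fin n → Set
u ⪯[ E ] v = ∃ λ ℓ → Walk E u v ℓ

-- "d_G(x,y) ≤ ℓ": there is a directed path from x to y of length at most ℓ
-- (d_G(x,y) = ∞ iff no such ℓ exists).
DistLe : ∀ {n} → Graph n → Fin n → Fin n → ℕ → Set
DistLe E x y ℓ = ∃ λ ℓ' → ℓ' ≤ ℓ × Walk E x y ℓ'

IsEmbedding : ∀ {n n'} → Graph n → Graph n' → (Fin n → Fin n') → Set
IsEmbedding E E' f = ∀ u v → (u ⪯[ E ] v) ⇔ (f u ⪯[ E' ] f v)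

-- Distance-increasing: d_G(x,y) ≤ d_G'(f x, f y) for all x, y
-- (with ∞ as top: whenever d_G'(f x,f y) ≤ ℓ then d_G(x,y) ≤ ℓ).
DistanceIncreasing : ∀ {n n'} → Graph n → Graph n' → (Fin n → Fin n') → Set
DistanceIncreasing E E' f = ∀ x y ℓ → DistLe E' (f x) (f y) ℓ → DistLe E x y ℓ

record Placement (n : ℕ) : Set₁ where
  constructor placement
  field
    inputs  : Pred (Fin n) 0ℓ
    outputs : Pred (Fin n) 0ℓ
open Placement public

Image : ∀ {n n'} → (Fin n → Fin n') → Pred (Fin n) 0ℓ → Pred (Fin n') 0ℓ
Image f S y = ∃ λ x → S x × f x ≡ y

_ᶠ[_] : ∀ {n n'} → Placement n → (Fin n → Fin n') → Placement n'
χ ᶠ[ f ] = placement (Image f (inputs χ)) (Image f (outputs χ))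

MeasPath : ∀ {n} → Graph n → Placement n → Pred (List (Fin n)) 0ℓ
MeasPath E χ p =
  Linked E p × Unique p ×
  (Σ (Fin _) λ x → Σ (Fin _) λ y →
     head p ≡ just x × last p ≡ just y × inputs χ x × outputs χ y × x ≢ y)

PathsThrough : ∀ {n} → Graph n → Placement n → Subset n → Pred (List (Fin n)) 0ℓ
PathsThrough E χ U p = MeasPath E χ p × (∃ λ u → u ∈ₛ U × u ∈ p)

Identifiable : ∀ {n} → Graph n → Placement n → ℕ → Set
Identifiable E χ k =
  ∀ (U W : Subset _) → ∣ U ∣ ≤ k → ∣ W ∣ ≤ k → U ≢ W →
  ¬ (∀ p → PathsThrough E χ U p ⇔ PathsThrough E χ W p)

-- μ(G|χ) is the largest k ≥ 0 such that G is k-identifiable (a supremum of a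
-- downward-closed subset of ℕ, possibly ∞). "k ≤ μ(G|χ)" is thus exactly
-- k-identifiability.
_≤μ[_∣_] : ∀ {n} → ℕ → Graph n → Placement n → Set
k ≤μ[ E ∣ χ ] = Identifiable E χ k

-- μ(G|χ) ≥ μ(G'|χ'): every lower bound of μ(G'|χ') is one of μ(G|χ).
_μ≥μ_ : ∀ {n n'} → (Graph n × Placement n) → (Graph n' × Placement n') → Set
(E , χ) μ≥μ (E' , χ') = ∀ k → k ≤μ[ E' ∣ χ' ] → k ≤μ[ E ∣ χ ]

{-# OPTIONS --safe #-}
module Submission where

-- Write g = f⁻¹, so that f(U) is the preimage of U under g. Distance-increasingness
-- forces every edge a → b of G' to come from an edge g a → g b of G, so g maps the
-- measurement paths of (G', χ^f) injectively to measurement paths of (G, χ), and a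
-- path of G' meets f(U) iff its g-image meets U. Hence two distinct sets U, W that
-- G cannot tell apart yield two distinct sets f(U), f(W) of the same sizes that G'
-- cannot tell apart either.

open import Defs
open import Data.Nat using (ℕ; suc; _≤_; s≤s; z≤n)
open import Data.Nat.Properties using (+-0-commutativeMonoid)
open import Data.Bool using (Bool)
open import Data.Fin using (Fin)
open import Data.Fin.Subset using (Subset; ∣_∣; inside; outside) renaming (_∈_ to _∈ₛ_)
open import Data.Fin.Permutation using (Permutation; _⟨$⟩ʳ_; _⟨$⟩ˡ_; inverseˡ; inverseʳ; flip)
open import Data.Vec using ([]; _∷_; lookup; tabulate)
open import Data.Vec.Properties using ([]=⇒lookup; lookup⇒[]=; lookup∘tabulate; tabulate∘lookup; tabulate-cong)
open import Data.List using (map)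
open import Data.List.Properties using (head-map; last-map)
open import Data.List.Membership.Propositional using (_∈_)
open import Data.List.Membership.Propositional.Properties using (∈-map⁺; ∈-map⁻)
import Data.List.Relation.Unary.Linked as Linked
import Data.List.Relation.Unary.Linked.Properties as Linked
import Data.List.Relation.Unary.Unique.Propositional.Properties as Unique
import Data.Maybe as Maybe
open import Data.Product using (_×_; _,_; ∃)
open import Data.Product.Function.NonDependent.Propositional using (_×-⇔_)
open import Data.Empty using (⊥-elim)
open import Function using (_∘_; id; _⇔_; mk⇔; Equivalence; module Injection)
open import Function.Bundles using (mk⤖)
open import Function.Definitions using (Bijective; Injective)
open import Function.Properties.Bijection using (⤖⇒↔)
open import Function.Properties.Inverse using (↔⇒↣)
open import Function.Construct.Symmetry using (⇔-sym)
open import Function.Construct.Composition using (_⇔-∘_)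
open import Function.Construct.Identity using (⇔-id)
open import Relation.Binary.Morphism.Definitions using (Homomorphic₂)
open import Relation.Binary.PropositionalEquality using (_≡_; _≗_; refl; sym; trans; cong; subst; subst₂; module ≡-Reasoning)
open import Relation.Unary using (Pred; _⊆_)
open import Algebra.Properties.CommutativeMonoid.Sum +-0-commutativeMonoid using (sum; sum-permute; sum-cong-≗)

private
  variable
    m n : ℕ

preimage : (Fin m → Fin n) → Subset n → Subset m
preimage h U = tabulate (lookup U ∘ h)

∈-preimage : ∀ {h : Fin m → Fin n} {U y} → y ∈ₛ preimage h U ⇔ h y ∈ₛ U
∈-preimage {h = h} {U} {y} = mk⇔
  (λ y∈ → lookup⇒[]= (h y) U (trans (sym (lookup∘tabulate _ y)) ([]=⇒lookup y∈)))
  (λ hy∈ → lookup⇒[]= y (preimage h U) (trans (lookup∘tabulate _ y) ([]=⇒lookup hy∈)))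

preimage-inverse : ∀ {h : Fin m → Fin n} {g : Fin n → Fin m} →
                   h ∘ g ≗ id → ∀ U → preimage g (preimage h U) ≡ U
preimage-inverse {h = h} {g} hg U = begin
  tabulate (lookup (tabulate (lookup U ∘ h)) ∘ g) ≡⟨ tabulate-cong (λ x → lookup∘tabulate _ (g x)) ⟩
  tabulate (lookup U ∘ h ∘ g)                     ≡⟨ tabulate-cong (cong (lookup U) ∘ hg) ⟩
  tabulate (lookup U)                             ≡⟨ tabulate∘lookup U ⟩
  U                                               ∎
  where open ≡-Reasoning

preimage-injective : (π : Permutation m n) {U W : Subset n} →
                     preimage (π ⟨$⟩ʳ_) U ≡ preimage (π ⟨$⟩ʳ_) W → U ≡ W
preimage-injective π {U} {W} eq = begin
  U                                          ≡⟨ preimage-inverse {h = π ⟨$⟩ʳ_} (λ _ → inverseʳ π) U ⟨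
  preimage (π ⟨$⟩ˡ_) (preimage (π ⟨$⟩ʳ_) U) ≡⟨ cong (preimage (π ⟨$⟩ˡ_)) eq ⟩
  preimage (π ⟨$⟩ˡ_) (preimage (π ⟨$⟩ʳ_) W) ≡⟨ preimage-inverse {h = π ⟨$⟩ʳ_} (λ _ → inverseʳ π) W ⟩
  W                                          ∎
  where open ≡-Reasoning

indicator : Bool → ℕ
indicator inside  = 1
indicator outside = 0

∣p∣≡∑indicator : (p : Subset n) → ∣ p ∣ ≡ sum (indicator ∘ lookup p)
∣p∣≡∑indicator []            = refl
∣p∣≡∑indicator (inside ∷ p)  = cong suc (∣p∣≡∑indicator p)
∣p∣≡∑indicator (outside ∷ p) = ∣p∣≡∑indicator p

∣preimage∣ : (π : Permutation m n) (U : Subset n) → ∣ preimage (π ⟨$⟩ʳ_) U ∣ ≡ ∣ U ∣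
∣preimage∣ π U = begin
  ∣ preimage (π ⟨$⟩ʳ_) U ∣                          ≡⟨ ∣p∣≡∑indicator (preimage (π ⟨$⟩ʳ_) U) ⟩
  sum (indicator ∘ lookup (preimage (π ⟨$⟩ʳ_) U))   ≡⟨ sum-cong-≗ (cong indicator ∘ lookup∘tabulate (lookup U ∘ (π ⟨$⟩ʳ_))) ⟩
  sum (indicator ∘ lookup U ∘ (π ⟨$⟩ʳ_))            ≡⟨ sum-permute (indicator ∘ lookup U) π ⟨
  sum (indicator ∘ lookup U)                        ≡⟨ ∣p∣≡∑indicator U ⟨
  ∣ U ∣                                             ∎
  where open ≡-Reasoning

Image⊆preimage : ∀ {f : Fin m → Fin n} {g : Fin n → Fin m} {S : Pred (Fin m) _} →
                 g ∘ f ≗ id → Image f S ⊆ S ∘ g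
Image⊆preimage {S = S} gf (x , Sx , refl) = subst S (sym (gf x)) Sx

walk₀⇒≡ : ∀ {E : Graph n} {x y} → Walk E x y 0 → x ≡ y
walk₀⇒≡ nil = refl

walk₁⇒edge : ∀ {E : Graph n} {x y} → Walk E x y 1 → E x y
walk₁⇒edge (cons e nil) = e

-- An edge f x → f y has distance 1, so d(x, y) ≤ 1; d(x, y) = 0 is ruled out
-- because it would make f x → f x a loop.
edge-reflect : ∀ {E : Graph m} {E' : Graph n} {f : Fin m → Fin n} → IsDAG E' →
               DistanceIncreasing E E' f → ∀ {x y} → E' (f x) (f y) → E x y
edge-reflect {f = f} dag dist {x} {y} e with dist x y 1 (1 , s≤s z≤n , cons e nil)
... | 0 , _ , w rewrite walk₀⇒≡ w = ⊥-elim (dag (f y) 0 (cons e nil))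
... | 1 , _ , w = walk₁⇒edge w
... | suc (suc _) , s≤s () , _

module _ {E' : Graph m} {E : Graph n} {χ' : Placement m} {χ : Placement n}
         {h : Fin m → Fin n} (h-injective : Injective _≡_ _≡_ h)
         (h-edge : Homomorphic₂ (Fin m) (Fin n) E' E h)
         (h-inputs : inputs χ' ⊆ inputs χ ∘ h) (h-outputs : outputs χ' ⊆ outputs χ ∘ h)
         where

  MeasPath-map : ∀ {p} → MeasPath E' χ' p → MeasPath E χ (map h p)
  MeasPath-map {p} (linked , unique , x , y , head≡x , last≡y , x∈in , y∈out , x≢y) =
    Linked.map⁺ (Linked.map h-edge linked) , Unique.map⁺ h-injective unique ,
    h x , h y ,
    trans (head-map p) (cong (Maybe.map h) head≡x) ,
    trans (last-map h p) (cong (Maybe.map h) last≡y) ,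
    h-inputs x∈in , h-outputs y∈out , x≢y ∘ h-injective

  PathsThrough-preimage : ∀ {U p} → PathsThrough E' χ' (preimage h U) p ⇔
                          (MeasPath E' χ' p × PathsThrough E χ U (map h p))
  PathsThrough-preimage {U} {p} = mk⇔
    (λ (path , u , u∈U , u∈p) →
       path , MeasPath-map path , h u , Equivalence.to ∈-preimage u∈U , ∈-map⁺ h u∈p)
    (λ { (path , _ , _ , hu∈U , hu∈hp) → from path hu∈U (∈-map⁻ h hu∈hp) })
    where
    from : ∀ {w} → MeasPath E' χ' p → w ∈ₛ U → ∃ (λ u → u ∈ p × w ≡ h u) →
           PathsThrough E' χ' (preimage h U) p
    from path w∈U (u , u∈p , refl) = path , u , Equivalence.from ∈-preimage w∈U , u∈p

  PathsThrough-preimage-cong : ∀ {U W} → (∀ p → PathsThrough E χ U p ⇔ PathsThrough E χ W p) →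
                               ∀ p → PathsThrough E' χ' (preimage h U) p ⇔ PathsThrough E' χ' (preimage h W) p
  PathsThrough-preimage-cong same p =
    ⇔-sym PathsThrough-preimage ⇔-∘ ((⇔-id _ ×-⇔ same (map h p)) ⇔-∘ PathsThrough-preimage)

Identifiable-reflect : ∀ {E' : Graph m} {E : Graph n} {χ' : Placement m} {χ : Placement n}
                       (π : Permutation m n) → Homomorphic₂ (Fin m) (Fin n) E' E (π ⟨$⟩ʳ_) →
                       inputs χ' ⊆ inputs χ ∘ (π ⟨$⟩ʳ_) → outputs χ' ⊆ outputs χ ∘ (π ⟨$⟩ʳ_) →
                       ∀ {k} → Identifiable E' χ' k → Identifiable E χ k
Identifiable-reflect π π-edge π-inputs π-outputs {k} identifiable U W ∣U∣≤k ∣W∣≤k U≢W same =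
  identifiable (preimage (π ⟨$⟩ʳ_) U) (preimage (π ⟨$⟩ʳ_) W)
    (subst (_≤ k) (sym (∣preimage∣ π U)) ∣U∣≤k)
    (subst (_≤ k) (sym (∣preimage∣ π W)) ∣W∣≤k)
    (U≢W ∘ preimage-injective π)
    (PathsThrough-preimage-cong (Injection.injective (↔⇒↣ π)) π-edge π-inputs π-outputs same)

theorem8 : ∀ {n n'} (E : Graph n) (E' : Graph n') (χ : Placement n)
             (f : Fin n → Fin n') →
             IsDAG E → IsDAG E' →
             Bijective _≡_ _≡_ f → IsEmbedding E E' f → DistanceIncreasing E E' f →
             (E , χ) μ≥μ (E' , χ ᶠ[ f ])
theorem8 {n} {n'} E E' _ _ _ dag' bijective _ distanceIncreasing _ =
  Identifiable-reflect (flip σ) f⁻¹-edge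
    (Image⊆preimage (λ _ → inverseˡ σ)) (Image⊆preimage (λ _ → inverseˡ σ))
  where
  σ : Permutation n n'
  σ = ⤖⇒↔ (mk⤖ bijective)

  f⁻¹-edge : Homomorphic₂ (Fin n') (Fin n) E' E (σ ⟨$⟩ˡ_)
  f⁻¹-edge e = edge-reflect dag' distanceIncreasing (subst₂ E' (sym (inverseʳ σ)) (sym (inverseʳ σ)) e)
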